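{- Let $0\le\ell\le 2k-1$, let $H$ be a configuration of the $(k,\ell)$-pebble game with colors, and let $v,w$ be vertices. Suppose some sequence of pebble-slide moves transforms $H$ into a configuration in which an add-edge move adding an edge between $v$ and $w$ is allowed. Then there is a sequence of pebble-slide moves with the following two properties: none of its moves creates a monochromatic cycle, and it transforms $H$ into a configuration in which that same add-edge move is allowed.
   Context: The $(k,\ell)$-pebble game with colors is played on a fixed finite vertex set $V$. Its state is a directed multigraph $H$ on $V$ (loops allowed) together with pebbles, each having one of $k$ colors $c_1,\dots,c_k$. Each pebble lies on a vertex or on an edge, and every edge carries exactly one pebble; the color of an edge is the color of its pebble. Initially $H$ has no edges and each vertex carries one pebble of each color. Moves: (add-edge) Let $v,w$ be vertices, not necessarily distinct, whose set $\{v,w\}$ carries at least $\ell+1$ pebbles in total, with $v$ carrying at least one pebble (relabel if needed). Pick up a pebble from $v$, add the directed edge $vw$, and put that pebble on it. (pebble-slide) Let $w$ carry a pebble $p$ and let $vw$ be an edge. Replace $vw$ by $wv$, put the pebble from $vw$ onto $v$, and put $p$ on $wv$. A configuration is any state reachable from the initial one by finitely many moves. A monochromatic cycle is a cycle (loops and pairs of parallel edges included) in the undirected graph formed by the edges of a single color. A move creates such a cycle if the cycle exists after the move but not before. -}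

module Defs where

open import Data.Nat using (ℕ; zero; suc; _+_; _∸_; _≤_; _<_)
open import Data.Fin using (Fin; toℕ; lower₁) renaming (zero to fzero; suc to fsuc)
open import Data.Fin.Properties using (_≟_)
open import Data.Nat.Properties using () renaming (_≟_ to _≟ℕ_)
open import Data.List using (List; []; _∷_; length; lookup; tabulate; _[_]∷=_)
open import Data.Nat.ListAction using (sum)
open import Data.Product using (Σ; _×_; _,_; ∃)
open import Data.Sum using (_⊎_)
open import Relation.Nullary using (¬_; yes; no)
open import Relation.Binary.PropositionalEquality using (_≡_)
open import Relation.Binary.Construct.Closure.ReflexiveTransitive using (Star)
open import Function.Definitions using (Injective)

-- Pebbles of the same color are indistinguishable, so a state records,
-- for every vertex and color, how many pebbles of that color lie on the
-- vertex, and the list of directed edges, each with the color of the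
-- pebble it carries.  An edge is identified by its position in the list
-- (positions are stable under pebble-slides).

Edge : ℕ → ℕ → Set
Edge n k = Fin n × Fin n × Fin k   -- (tail , head , color)

record State (n k : ℕ) : Set where
  constructor ⟨_,_⟩
  field
    peb   : Fin n → Fin k → ℕ
    edges : List (Edge n k)
open State public

initial : ∀ {n k} → State n k
initial = ⟨ (λ _ _ → 1) , [] ⟩

incP : ∀ {n k} → Fin n → Fin k → (Fin n → Fin k → ℕ) → Fin n → Fin k → ℕ
incP x c f y d with x ≟ y | c ≟ d
... | yes _ | yes _ = suc (f y d)
... | _     | _     = f y d

decP : ∀ {n k} → Fin n → Fin k → (Fin n → Fin k → ℕ) → Fin n → Fin k → ℕ
decP x c f y d with x ≟ y | c ≟ d
... | yes _ | yes _ = f y d ∸ 1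
... | _     | _     = f y d

pebCount : ∀ {n k} → State n k → Fin n → ℕ
pebCount H v = sum (tabulate (peb H v))

pebOnPair : ∀ {n k} → State n k → Fin n → Fin n → ℕ
pebOnPair H v w with v ≟ w
... | yes _ = pebCount H v
... | no  _ = pebCount H v + pebCount H w

data AddEdge {n k : ℕ} (ℓ : ℕ) : State n k → State n k → Set where
  add-edge : ∀ {H} (v w : Fin n) (c : Fin k) →
             1 ≤ peb H v c → ℓ + 1 ≤ pebOnPair H v w →
             AddEdge ℓ H ⟨ decP v c (peb H) , (v , w , c) ∷ edges H ⟩

data Slide {n k : ℕ} : State n k → State n k → Set where
  slide : ∀ {H} (i : Fin (length (edges H))) (v w : Fin n) (c c' : Fin k) →
          lookup (edges H) i ≡ (v , w , c) → 1 ≤ peb H w c' →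
          Slide H ⟨ incP v c (decP w c' (peb H)) , edges H [ i ]∷= (w , v , c') ⟩

data Move {n k : ℕ} (ℓ : ℕ) (H H' : State n k) : Set where
  addMove   : AddEdge ℓ H H' → Move ℓ H H'
  slideMove : Slide H H' → Move ℓ H H'

Configuration : ∀ {n k} (ℓ : ℕ) → State n k → Set
Configuration ℓ H = Star (Move ℓ) initial H

-- an add-edge move adding an edge between v and w is allowed in H
-- (from v to w, or, after relabelling, from w to v)
AddAllowedFrom : ∀ {n k} (ℓ : ℕ) → State n k → Fin n → Fin n → Set
AddAllowedFrom ℓ H v w = (1 ≤ pebCount H v) × (ℓ + 1 ≤ pebOnPair H v w)

AddAllowed : ∀ {n k} (ℓ : ℕ) → State n k → Fin n → Fin n → Set
AddAllowed ℓ H v w = AddAllowedFrom ℓ H v w ⊎ AddAllowedFrom ℓ H w v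

EdgeAt : ∀ {n k} → List (Edge n k) → ℕ → Edge n k → Set
EdgeAt E i e = Σ (Fin (length E)) λ j → (toℕ j ≡ i) × (lookup E j ≡ e)

next : ∀ {m} → Fin (suc m) → Fin (suc m)
next {m} j with m ≟ℕ toℕ j
... | yes _ = fzero
... | no ne = fsuc (lower₁ j ne)

-- A cycle of color c and length m+1 in the undirected multigraph of the
-- edges of color c: distinct vertices vs 0 , … , vs m and distinct edges
-- (positions) es 0 , … , es m, where edge es j joins vs j and vs (j+1 mod m+1).
-- Length 1 = loop, length 2 = pair of parallel edges.
IsCycle : ∀ {n k} → List (Edge n k) → Fin k → (m : ℕ) →
          (Fin (suc m) → Fin n) → (Fin (suc m) → ℕ) → Set
IsCycle E c m vs es =
  Injective _≡_ _≡_ vs × Injective _≡_ _≡_ es ×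
  (∀ j → EdgeAt E (es j) (vs j , vs (next j) , c)
       ⊎ EdgeAt E (es j) (vs (next j) , vs j , c))

CreatesMonoCycle : ∀ {n k} → State n k → State n k → Set
CreatesMonoCycle {n} {k} H H' =
  Σ (Fin k) λ c → Σ ℕ λ m → Σ (Fin (suc m) → Fin n) λ vs → Σ (Fin (suc m) → ℕ) λ es →
    IsCycle (edges H') c m vs es × ¬ IsCycle (edges H) c m vs es

CleanSlide : ∀ {n k} → State n k → State n k → Set
CleanSlide H H' = Slide H H' × ¬ CreatesMonoCycle H H'

-- Every pebble of color c that started on a vertex y lies on y or on an
-- out-edge of y of color c, so each vertex has at most one out-edge of each
-- color and every monochromatic cycle is a directed cycle.
--
-- Let S = {v, w}.  A slide preserves, for any vertex set X, the number of
-- pebbles on X plus the number of arcs with tail in X, and also the number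
-- of arcs inside X.  If X is the set reached from S, no arc leaves X, so no
-- sequence of slides puts more pebbles on X; when all pebbles of X lie on S,
-- S cannot gain pebbles either.  Otherwise a pebble on some u ∉ S is reached
-- from S along a path P, and clean slides bring it to S: if a vertex of P
-- reaches u in the pebble's color c, reversing such a monochromatic path
-- moves the pebble there without changing any color class; if none does,
-- sliding the pebble onto the last arc of P recolors that arc with c, and a
-- new c-cycle would need a directed c-path from its tail back to u.  Each
-- round puts one more pebble on S, until the add-edge move is allowed.

module Submission where

open import Defs
open import Data.Nat using (ℕ; _<_; _*_)
open import Data.Fin using (Fin)
open import Data.Product using (∃; _×_)
open import Relation.Binary.Construct.Closure.ReflexiveTransitive using (Star)

open import Data.Nat using (zero; suc; _+_; _∸_; _≤_; _≤?_; z≤n; s≤s; _≟_)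
open import Data.Nat.Properties
open import Data.Nat.Tactic.RingSolver using (solve-∀)
open import Data.Fin using (zero; suc; toℕ; fromℕ; punchIn; punchOut)
import Data.Fin.Properties as Fin
open import Data.List as List using (List; []; _∷_; length; lookup; _[_]∷=_)
import Data.Nat.ListAction as ListAction
open import Data.Maybe using (Maybe; just; nothing)
open import Data.Maybe.Properties using (just-injective)
open import Data.Product using (Σ; _,_; proj₁; proj₂; ∃₂)
open import Data.Sum as Sum using (_⊎_; inj₁; inj₂; [_,_]′)
open import Data.Empty using (⊥; ⊥-elim)
open import Function using (_∘_; id)
open import Data.List.Relation.Unary.All as All using (All; []; _∷_)
open import Data.List.Relation.Unary.All.Properties using (¬Any⇒All¬)
open import Data.List.Relation.Unary.Any using (here; there)
open import Data.List.Relation.Unary.Unique.Propositional using (Unique)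
open import Data.List.Relation.Unary.AllPairs using ([]; _∷_)
import Data.List.Membership.DecPropositional as Membership
import Data.Product.Properties as Product
open import Relation.Nullary using (Dec; yes; no; ¬_; contradiction)
open import Relation.Nullary.Decidable using (_×-dec_; _⊎-dec_; ¬?; decidable-stable)
open import Relation.Binary.PropositionalEquality
open import Relation.Binary.Construct.Closure.ReflexiveTransitive using (ε; _◅_; _◅◅_; gmap; reverse; fold)
open import Algebra.Properties.CommutativeMonoid.Sum +-0-commutativeMonoid
  using (sum; sum-cong-≗; ∑-distrib-+; sum-remove)
open import Algebra.Properties.CommutativeSemigroup +-commutativeSemigroup
  using (xy∙z≈xz∙y; interchange)

-- Finite sums

sum-tabulate : ∀ {m} (f : Fin m → ℕ) → ListAction.sum (List.tabulate f) ≡ sum f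
sum-tabulate {zero}  f = refl
sum-tabulate {suc m} f = cong (f zero +_) (sum-tabulate (f ∘ suc))

sum-zero : ∀ {m} {f : Fin m → ℕ} → (∀ i → f i ≡ 0) → sum f ≡ 0
sum-zero {zero}  f≡0 = refl
sum-zero {suc m} f≡0 = cong₂ _+_ (f≡0 zero) (sum-zero (f≡0 ∘ suc))

sum-mono-≤ : ∀ {m} {f g : Fin m → ℕ} → (∀ i → f i ≤ g i) → sum f ≤ sum g
sum-mono-≤ {zero}  f≤g = z≤n
sum-mono-≤ {suc m} f≤g = +-mono-≤ (f≤g zero) (sum-mono-≤ (f≤g ∘ suc))

sum-mono-< : ∀ {m} {f g : Fin m → ℕ} i → (∀ j → f j ≤ g j) → f i < g i → sum f < sum g
sum-mono-< {suc m} {f} {g} i f≤g fi<gi = begin-strict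
  sum f                          ≡⟨ sum-remove f ⟩
  f i + sum (f ∘ punchIn i)      <⟨ +-mono-<-≤ fi<gi (sum-mono-≤ (f≤g ∘ punchIn i)) ⟩
  g i + sum (g ∘ punchIn i)      ≡⟨ sum-remove g ⟨
  sum g                          ∎
  where open ≤-Reasoning

≤-sum : ∀ {m} (f : Fin m → ℕ) i → f i ≤ sum f
≤-sum {suc m} f i = subst (f i ≤_) (sym (sum-remove f)) (m≤m+n (f i) _)

sum-+-cong : ∀ {m} {f g f′ g′ : Fin m → ℕ} → (∀ i → f i + g i ≡ f′ i + g′ i) →
             sum f + sum g ≡ sum f′ + sum g′
sum-+-cong {f = f} {g} {f′} {g′} eq = begin
  sum f + sum g                  ≡⟨ ∑-distrib-+ f g ⟨
  sum (λ i → f i + g i)          ≡⟨ sum-cong-≗ eq ⟩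
  sum (λ i → f′ i + g′ i)        ≡⟨ ∑-distrib-+ f′ g′ ⟩
  sum f′ + sum g′                ∎
  where open ≡-Reasoning

sum-supported : ∀ {m} (f : Fin m → ℕ) i → (∀ j → j ≢ i → f j ≡ 0) → sum f ≡ f i
sum-supported {suc m} f i f≡0 = begin
  sum f                          ≡⟨ sum-remove f ⟩
  f i + sum (f ∘ punchIn i)      ≡⟨ cong (f i +_) (sum-zero (λ j → f≡0 _ (Fin.punchInᵢ≢i i j))) ⟩
  f i + 0                        ≡⟨ +-identityʳ (f i) ⟩
  f i                            ∎
  where open ≡-Reasoning

sum-supported₂ : ∀ {m} (f : Fin m → ℕ) i j → i ≢ j → (∀ l → l ≢ i → l ≢ j → f l ≡ 0) →
                 sum f ≡ f i + f j
sum-supported₂ {suc m} f i j i≢j f≡0 = begin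
  sum f                                  ≡⟨ sum-remove f ⟩
  f i + sum (f ∘ punchIn i)              ≡⟨ cong (f i +_) (sum-supported (f ∘ punchIn i) j′ off-j′) ⟩
  f i + f (punchIn i j′)                 ≡⟨ cong (λ l → f i + f l) (Fin.punchIn-punchOut i≢j) ⟩
  f i + f j                              ∎
  where
  open ≡-Reasoning
  j′ : Fin _
  j′ = punchOut i≢j
  off-j′ : ∀ l → l ≢ j′ → f (punchIn i l) ≡ 0
  off-j′ l l≢j′ = f≡0 _ (Fin.punchInᵢ≢i i l) λ eq →
    l≢j′ (trans (sym (Fin.punchOut-punchIn i)) (Fin.punchOut-cong i eq))

sum-const-1 : ∀ m → sum {m} (λ _ → 1) ≡ m
sum-const-1 zero    = refl
sum-const-1 (suc m) = cong suc (sum-const-1 m)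

sum-positive : ∀ {m} (f : Fin m → ℕ) → 1 ≤ sum f → ∃ λ i → 1 ≤ f i
sum-positive f 1≤sum with Fin.any? (λ i → 1 ≤? f i)
... | yes found = found
... | no none = contradiction (sum-zero (λ i → n<1⇒n≡0 (≰⇒> (λ 1≤fi → none (i , 1≤fi))))) λ sum≡0 →
  1+n≰n (subst (1 ≤_) sum≡0 1≤sum)

𝟙 : ∀ {p} {P : Set p} → Dec P → ℕ
𝟙 (yes _) = 1
𝟙 (no _)  = 0

𝟙-yes : ∀ {p} {P : Set p} (p? : Dec P) → P → 𝟙 p? ≡ 1
𝟙-yes (yes _) _  = refl
𝟙-yes (no ¬p) pr = contradiction pr ¬p

𝟙-no : ∀ {p} {P : Set p} (p? : Dec P) → ¬ P → 𝟙 p? ≡ 0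
𝟙-no (yes pr) ¬p = contradiction pr ¬p
𝟙-no (no _)   _  = refl

𝟙≤1 : ∀ {p} {P : Set p} (p? : Dec P) → 𝟙 p? ≤ 1
𝟙≤1 (yes _) = ≤-refl
𝟙≤1 (no _)  = z≤n

𝟙-mono : ∀ {p q} {P : Set p} {Q : Set q} → (P → Q) → (p? : Dec P) (q? : Dec Q) → 𝟙 p? ≤ 𝟙 q?
𝟙-mono P⇒Q (yes p) (yes _) = ≤-refl
𝟙-mono P⇒Q (yes p) (no ¬q) = contradiction (P⇒Q p) ¬q
𝟙-mono P⇒Q (no _)  _       = z≤n

δ : ∀ {m} → Fin m → Fin m → ℕ
δ i j = 𝟙 (i Fin.≟ j)

δ-refl : ∀ {m} (i : Fin m) → δ i i ≡ 1
δ-refl i = 𝟙-yes (i Fin.≟ i) refl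

δ-≢ : ∀ {m} {i j : Fin m} → i ≢ j → δ i j ≡ 0
δ-≢ {i = i} {j} = 𝟙-no (i Fin.≟ j)

sum-*δ : ∀ {m} (f : Fin m → ℕ) i → sum (λ j → f j * δ i j) ≡ f i
sum-*δ f i = begin
  sum (λ j → f j * δ i j)   ≡⟨ sum-supported _ i off-i ⟩
  f i * δ i i               ≡⟨ cong (f i *_) (δ-refl i) ⟩
  f i * 1                   ≡⟨ *-identityʳ (f i) ⟩
  f i                       ∎
  where
  open ≡-Reasoning
  off-i : ∀ j → j ≢ i → f j * δ i j ≡ 0
  off-i j j≢i = trans (cong (f j *_) (δ-≢ (j≢i ∘ sym))) (*-zeroʳ (f j))

lookupℕ : ∀ {a} {A : Set a} → List A → ℕ → Maybe A
lookupℕ []       _       = nothing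
lookupℕ (x ∷ xs) zero    = just x
lookupℕ (x ∷ xs) (suc q) = lookupℕ xs q

module _ {a} {A : Set a} where

  lookupℕ-lookup : ∀ (xs : List A) i → lookupℕ xs (toℕ i) ≡ just (lookup xs i)
  lookupℕ-lookup (x ∷ xs) zero    = refl
  lookupℕ-lookup (x ∷ xs) (suc i) = lookupℕ-lookup xs i

  lookupℕ⇒lookup : ∀ (xs : List A) q {x} → lookupℕ xs q ≡ just x →
                   ∃ λ i → toℕ i ≡ q × lookup xs i ≡ x
  lookupℕ⇒lookup (y ∷ xs) zero    refl = zero , refl , refl
  lookupℕ⇒lookup (y ∷ xs) (suc q) eq
    with i , refl , xs[i]≡x ← lookupℕ⇒lookup xs q eq = suc i , refl , xs[i]≡x

  lookupℕ-∷=-updated : ∀ (xs : List A) i x → lookupℕ (xs [ i ]∷= x) (toℕ i) ≡ just x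
  lookupℕ-∷=-updated (y ∷ xs) zero    x = refl
  lookupℕ-∷=-updated (y ∷ xs) (suc i) x = lookupℕ-∷=-updated xs i x

  lookupℕ-∷=-other : ∀ (xs : List A) i x q → q ≢ toℕ i → lookupℕ (xs [ i ]∷= x) q ≡ lookupℕ xs q
  lookupℕ-∷=-other (y ∷ xs) zero    x zero    q≢i = contradiction refl q≢i
  lookupℕ-∷=-other (y ∷ xs) zero    x (suc q) q≢i = refl
  lookupℕ-∷=-other (y ∷ xs) (suc i) x zero    q≢i = refl
  lookupℕ-∷=-other (y ∷ xs) (suc i) x (suc q) q≢i = lookupℕ-∷=-other xs i x q (q≢i ∘ cong suc)

  module _ (f : A → ℕ) where

    sumMap : List A → ℕ
    sumMap xs = ListAction.sum (List.map f xs)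

    sumMap-∷= : ∀ xs i x → sumMap (xs [ i ]∷= x) + f (lookup xs i) ≡ sumMap xs + f x
    sumMap-∷= (y ∷ xs) zero    x = swap (f x) (sumMap xs) (f y)
      where
      swap : ∀ a s b → a + s + b ≡ b + s + a
      swap = solve-∀
    sumMap-∷= (y ∷ xs) (suc i) x = trans (+-assoc (f y) _ _)
      (trans (cong (f y +_) (sumMap-∷= xs i x)) (sym (+-assoc (f y) _ _)))

    ≤-sumMap : ∀ xs q {x} → lookupℕ xs q ≡ just x → f x ≤ sumMap xs
    ≤-sumMap (y ∷ xs) zero    refl = m≤m+n (f y) _
    ≤-sumMap (y ∷ xs) (suc q) eq   = ≤-trans (≤-sumMap xs q eq) (m≤n+m _ (f y))

    ≤-sumMap₂ : ∀ xs p q {x y} → p ≢ q → lookupℕ xs p ≡ just x → lookupℕ xs q ≡ just y →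
                f x + f y ≤ sumMap xs
    ≤-sumMap₂ (z ∷ xs) zero    zero    p≢q _    _    = contradiction refl p≢q
    ≤-sumMap₂ (z ∷ xs) zero    (suc q) p≢q refl eq   = +-monoʳ-≤ (f z) (≤-sumMap xs q eq)
    ≤-sumMap₂ (z ∷ xs) (suc p) zero    p≢q eq   refl =
      subst (_≤ f z + sumMap xs) (+-comm (f z) _) (+-monoʳ-≤ (f z) (≤-sumMap xs p eq))
    ≤-sumMap₂ (z ∷ xs) (suc p) (suc q) p≢q eq₁  eq₂  =
      ≤-trans (≤-sumMap₂ xs p q (p≢q ∘ cong suc) eq₁ eq₂) (m≤n+m _ (f z))

  sumMap-mono-≤ : ∀ {f g : A → ℕ} → (∀ x → f x ≤ g x) → ∀ xs → sumMap f xs ≤ sumMap g xs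
  sumMap-mono-≤ f≤g []       = z≤n
  sumMap-mono-≤ f≤g (x ∷ xs) = +-mono-≤ (f≤g x) (sumMap-mono-≤ f≤g xs)

  sumMap-cong : ∀ {f g : A → ℕ} xs → (∀ q {x} → lookupℕ xs q ≡ just x → f x ≡ g x) →
                sumMap f xs ≡ sumMap g xs
  sumMap-cong []       f≡g = refl
  sumMap-cong (x ∷ xs) f≡g = cong₂ _+_ (f≡g zero refl) (sumMap-cong xs (f≡g ∘ suc))

+-exchange : ∀ {a b c d x y} → a + x ≡ b + y → c + y ≡ d + x → a + c ≡ b + d
+-exchange {a} {b} {c} {d} {x} {y} e₁ e₂ = +-cancelʳ-≡ (x + y) _ _ (begin
  a + c + (x + y)   ≡⟨ interchange a c x y ⟩
  a + x + (c + y)   ≡⟨ cong₂ _+_ e₁ e₂ ⟩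
  b + y + (d + x)   ≡⟨ interchange b y d x ⟩
  b + d + (y + x)   ≡⟨ cong (b + d +_) (+-comm y x) ⟩
  b + d + (x + y)   ∎)
  where open ≡-Reasoning

-- Pebble bookkeeping

module _ {n k : ℕ} where

  incP-δ : ∀ x c (f : Fin n → Fin k → ℕ) y d → incP x c f y d ≡ f y d + δ x y * δ c d
  incP-δ x c f y d with x Fin.≟ y | c Fin.≟ d
  ... | yes _ | yes _ = +-comm 1 (f y d)
  ... | yes _ | no _  = sym (+-identityʳ (f y d))
  ... | no _  | _     = sym (+-identityʳ (f y d))

  decP-δ : ∀ x c (f : Fin n → Fin k → ℕ) → 1 ≤ f x c → ∀ y d → decP x c f y d + δ x y * δ c d ≡ f y d
  decP-δ x c f 1≤f y d with x Fin.≟ y | c Fin.≟ d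
  ... | yes refl | yes refl = m∸n+n≡m 1≤f
  ... | yes _    | no _     = +-identityʳ (f y d)
  ... | no _     | _        = +-identityʳ (f y d)

  afterSlide : (G : State n k) → Fin (length (edges G)) → (v w : Fin n) (c c′ : Fin k) → State n k
  afterSlide G i v w c c′ = ⟨ incP v c (decP w c′ (peb G)) , edges G [ i ]∷= (w , v , c′) ⟩

  afterSlide-peb : ∀ G i v w c c′ → 1 ≤ peb G w c′ → ∀ y d →
                   peb (afterSlide G i v w c c′) y d + δ w y * δ c′ d ≡ peb G y d + δ v y * δ c d
  afterSlide-peb G i v w c c′ 1≤peb y d = begin
    incP v c g y d + δ w y * δ c′ d          ≡⟨ cong (_+ δ w y * δ c′ d) (incP-δ v c g y d) ⟩
    g y d + δ v y * δ c d + δ w y * δ c′ d   ≡⟨ xy∙z≈xz∙y (g y d) _ _ ⟩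
    g y d + δ w y * δ c′ d + δ v y * δ c d   ≡⟨ cong (_+ δ v y * δ c d) (decP-δ w c′ (peb G) 1≤peb y d) ⟩
    peb G y d + δ v y * δ c d                ∎
    where
    open ≡-Reasoning
    g : Fin n → Fin k → ℕ
    g = decP w c′ (peb G)

  -- G′ is G with one pebble moved from u to z (stated additively to avoid ∸).
  record Moved (G G′ : State n k) (u z : Fin n) : Set where
    constructor moved
    field balance : ∀ y → pebCount G′ y + δ u y ≡ pebCount G y + δ z y

  Moved-refl : ∀ {G u} → Moved G G u u
  Moved-refl = moved λ _ → refl

  Moved-trans : ∀ {G₁ G₂ G₃ u z s} → Moved G₁ G₂ u z → Moved G₂ G₃ z s → Moved G₁ G₃ u s
  Moved-trans {G₁} {G₂} {G₃} {u} {z} {s} (moved u→z) (moved z→s) = moved λ y → +-cancelʳ-≡ (δ z y) _ _ (begin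
    pebCount G₃ y + δ u y + δ z y   ≡⟨ xy∙z≈xz∙y (pebCount G₃ y) _ _ ⟩
    pebCount G₃ y + δ z y + δ u y   ≡⟨ cong (_+ δ u y) (z→s y) ⟩
    pebCount G₂ y + δ s y + δ u y   ≡⟨ xy∙z≈xz∙y (pebCount G₂ y) _ _ ⟩
    pebCount G₂ y + δ u y + δ s y   ≡⟨ cong (_+ δ s y) (u→z y) ⟩
    pebCount G₁ y + δ z y + δ s y   ≡⟨ xy∙z≈xz∙y (pebCount G₁ y) _ _ ⟩
    pebCount G₁ y + δ s y + δ z y   ∎)
    where open ≡-Reasoning

  Moved-afterSlide : ∀ G i v w c c′ → 1 ≤ peb G w c′ → Moved G (afterSlide G i v w c c′) w v
  Moved-afterSlide G i v w c c′ 1≤peb = moved λ y → begin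
    pebCount G′ y + δ w y
      ≡⟨ cong₂ _+_ (sum-tabulate (peb G′ y)) (sym (sum-*δ (λ _ → δ w y) c′)) ⟩
    sum (peb G′ y) + sum (λ d → δ w y * δ c′ d)
      ≡⟨ sum-+-cong (afterSlide-peb G i v w c c′ 1≤peb y) ⟩
    sum (peb G y) + sum (λ d → δ v y * δ c d)
      ≡⟨ cong₂ _+_ (sym (sum-tabulate (peb G y))) (sum-*δ (λ _ → δ v y) c) ⟩
    pebCount G y + δ v y
      ∎
    where
    open ≡-Reasoning
    G′ : State n k
    G′ = afterSlide G i v w c c′

  Moved⇒pebble : ∀ {G G′ u z} → Moved G G′ u z → 1 ≤ pebCount G u → 1 ≤ pebCount G′ z
  Moved⇒pebble {G} {G′} {u} {z} (moved u→z) 1≤pc with u Fin.≟ z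
  ... | yes refl = subst (1 ≤_) (sym (+-cancelʳ-≡ (δ u u) _ _ (u→z u))) 1≤pc
  ... | no u≢z   = subst (1 ≤_) (sym (begin
    pebCount G′ z           ≡⟨ +-identityʳ _ ⟨
    pebCount G′ z + 0       ≡⟨ cong (pebCount G′ z +_) (δ-≢ u≢z) ⟨
    pebCount G′ z + δ u z   ≡⟨ u→z z ⟩
    pebCount G z + δ z z    ≡⟨ cong (pebCount G z +_) (δ-refl z) ⟩
    pebCount G z + 1        ∎)) (m≤n+m 1 _)
    where open ≡-Reasoning

  pebble-color : ∀ (G : State n k) y → 1 ≤ pebCount G y → ∃ λ c → 1 ≤ peb G y c
  pebble-color G y 1≤pc = sum-positive (peb G y) (subst (1 ≤_) (sum-tabulate (peb G y)) 1≤pc)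

  isOutEdge : Fin n → Fin k → Edge n k → ℕ
  isOutEdge y d (s , _ , c) = δ s y * δ c d

  -- The pebble of color d that started on y is on y or on an edge out of y.
  PebbleInvariant : State n k → Set
  PebbleInvariant G = ∀ y d → peb G y d + sumMap (isOutEdge y d) (edges G) ≡ 1

  PebbleInvariant-add : ∀ {ℓ} {G G′ : State n k} → AddEdge ℓ G G′ → PebbleInvariant G → PebbleInvariant G′
  PebbleInvariant-add {G = G} (add-edge v w c 1≤peb _) inv y d = begin
    decP v c (peb G) y d + (δ v y * δ c d + outdeg)   ≡⟨ +-assoc (decP v c (peb G) y d) _ _ ⟨
    decP v c (peb G) y d + δ v y * δ c d + outdeg     ≡⟨ cong (_+ outdeg) (decP-δ v c (peb G) 1≤peb y d) ⟩
    peb G y d + outdeg                                ≡⟨ inv y d ⟩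
    1                                                 ∎
    where
    open ≡-Reasoning
    outdeg : ℕ
    outdeg = sumMap (isOutEdge y d) (edges G)

  PebbleInvariant-slide : ∀ {G G′ : State n k} → Slide G G′ → PebbleInvariant G → PebbleInvariant G′
  PebbleInvariant-slide {G} (slide i v w c c′ E[i]≡vw 1≤peb) inv y d =
    trans (+-exchange {a = peb (afterSlide G i v w c c′) y d} (afterSlide-peb G i v w c c′ 1≤peb y d)
             (subst (λ e → sumMap out E′ + out e ≡ sumMap out (edges G) + δ w y * δ c′ d) E[i]≡vw
                    (sumMap-∷= out (edges G) i (w , v , c′))))
          (inv y d)
    where
    E′ : List (Edge n k)
    E′ = edges G [ i ]∷= (w , v , c′)
    out : Edge n k → ℕ
    out = isOutEdge y d

  PebbleInvariant-moves : ∀ {ℓ} {G G′ : State n k} → Star (Move ℓ) G G′ → PebbleInvariant G → PebbleInvariant G′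
  PebbleInvariant-moves ε                    inv = inv
  PebbleInvariant-moves (addMove m   ◅ moves) inv = PebbleInvariant-moves moves (PebbleInvariant-add m inv)
  PebbleInvariant-moves (slideMove m ◅ moves) inv = PebbleInvariant-moves moves (PebbleInvariant-slide m inv)

  PebbleInvariant-configuration : ∀ {ℓ} {G : State n k} → Configuration ℓ G → PebbleInvariant G
  PebbleInvariant-configuration conf = PebbleInvariant-moves conf (λ _ _ → refl)

  UniqueOutEdges : List (Edge n k) → Set
  UniqueOutEdges E = ∀ {p q s t t′ c} → lookupℕ E p ≡ just (s , t , c) → lookupℕ E q ≡ just (s , t′ , c) → p ≡ q

  PebbleInvariant⇒UniqueOutEdges : ∀ {G : State n k} → PebbleInvariant G → UniqueOutEdges (edges G)
  PebbleInvariant⇒UniqueOutEdges {G} inv {p} {q} {s} {t} {t′} {c} E[p] E[q] with p ≟ q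
  ... | yes p≡q = p≡q
  ... | no p≢q  = contradiction (begin
    2                                                          ≡⟨ cong₂ _+_ (out-self t) (out-self t′) ⟨
    isOutEdge s c (s , t , c) + isOutEdge s c (s , t′ , c)     ≤⟨ ≤-sumMap₂ (isOutEdge s c) (edges G) p q p≢q E[p] E[q] ⟩
    sumMap (isOutEdge s c) (edges G)                           ≤⟨ m≤n+m _ (peb G s c) ⟩
    peb G s c + sumMap (isOutEdge s c) (edges G)               ≡⟨ inv s c ⟩
    1                                                          ∎) (1+n≰n {1})
    where
    open ≤-Reasoning
    out-self : ∀ t → isOutEdge s c (s , t , c) ≡ 1
    out-self t = cong₂ _*_ (δ-refl s) (δ-refl c)

-- Walks

module _ {n : ℕ} {R : Fin n → Fin n → Set} where

  open Membership (Fin._≟_ {n}) using (_∈_; _∈?_)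

  tails : ∀ {a b} → Star R a b → List (Fin n)
  tails ε                 = []
  tails (_◅_ {a} _ walk)  = a ∷ tails walk

  verts : ∀ {a b} → Star R a b → List (Fin n)
  verts {a} ε             = a ∷ []
  verts (_◅_ {a} _ walk)  = a ∷ verts walk

  All-verts⇒start : ∀ {P : Fin n → Set} {a b} (walk : Star R a b) → All P (verts walk) → P a
  All-verts⇒start ε          (pa ∷ _) = pa
  All-verts⇒start (_ ◅ walk) (pa ∷ _) = pa

  All-verts⇒end : ∀ {P : Fin n → Set} {a b} (walk : Star R a b) → All P (verts walk) → P b
  All-verts⇒end ε          (pb ∷ []) = pb
  All-verts⇒end (_ ◅ walk) (_ ∷ ps)  = All-verts⇒end walk ps

  tails-reach : ∀ {a b} (walk : Star R a b) → All (λ t → Star R t b) (tails walk)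
  tails-reach ε          = []
  tails-reach (r ◅ walk) = (r ◅ walk) ∷ tails-reach walk

  unsnoc : ∀ {a b} (walk : Star R a b) →
           a ≡ b ⊎ ∃ λ x → Σ (Star R a x) λ prefix → R x b × length (tails prefix) < length (tails walk)
  unsnoc ε = inj₁ refl
  unsnoc (r ◅ walk) with unsnoc walk
  ... | inj₁ refl                        = inj₂ (_ , ε , r , s≤s z≤n)
  ... | inj₂ (x , prefix , r′ , shorter) = inj₂ (x , r ◅ prefix , r′ , s≤s shorter)

  avoidingEnd : ∀ {a b} → Star R a b → Σ (Star R a b) λ walk → All (_≢ b) (tails walk)
  avoidingEnd ε = ε , []
  avoidingEnd {a} {b} (r ◅ walk) with a Fin.≟ b
  ... | yes refl = ε , []
  ... | no a≢b   = let walk′ , avoids = avoidingEnd walk in r ◅ walk′ , a≢b ∷ avoids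

  module _ {P : Fin n → Set} (P? : ∀ x → Dec (P x)) where

    firstSatisfying : ∀ {a b} (walk : Star R a b) →
                      All (¬_ ∘ P) (verts walk) ⊎
                      ∃ λ z → Σ (Star R a z) λ prefix →
                        All (¬_ ∘ P) (tails prefix) × P z × length (tails prefix) ≤ length (tails walk)
    firstSatisfying {a} walk with P? a
    ... | yes pa = inj₂ (a , ε , [] , pa , z≤n)
    firstSatisfying ε          | no ¬pa = inj₁ (¬pa ∷ [])
    firstSatisfying (r ◅ walk) | no ¬pa with firstSatisfying walk
    ... | inj₁ none = inj₁ (¬pa ∷ none)
    ... | inj₂ (z , prefix , none , pz , shorter) = inj₂ (z , r ◅ prefix , ¬pa ∷ none , pz , s≤s shorter)

  private
    dropUntil : ∀ {a x b} (walk : Star R x b) → Unique (tails walk) → a ∈ tails walk →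
                Σ (Star R a b) (Unique ∘ tails)
    dropUntil (r ◅ walk) unique     (here refl) = r ◅ walk , unique
    dropUntil (r ◅ walk) (_ ∷ unique) (there a∈) = dropUntil walk unique a∈

  simplify : ∀ {a b} → Star R a b → Σ (Star R a b) (Unique ∘ tails)
  simplify ε = ε , []
  simplify {a} (r ◅ walk) with simplify walk
  ... | walk′ , unique with a ∈? tails walk′
  ...   | yes a∈ = dropUntil walk′ unique a∈
  ...   | no a∉  = r ◅ walk′ , ¬Any⇒All¬ _ a∉ ∷ unique

module _ {n : ℕ} {R R′ : Fin n → Fin n → Set} (P : Fin n → Set) where

  map-tails : (∀ {x y} → P x → R x y → R′ x y) →
              ∀ {a b} (walk : Star R a b) → All P (tails walk) → Star R′ a b
  map-tails f ε          []        = ε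
  map-tails f (r ◅ walk) (pa ∷ ps) = f pa r ◅ map-tails f walk ps

  map-verts : (∀ {x y} → P y → R x y → R′ x y) →
              ∀ {a b} (walk : Star R a b) → All P (verts walk) → Star R′ a b
  map-verts f ε          _        = ε
  map-verts f (r ◅ walk) (_ ∷ ps) = f (All-verts⇒start walk ps) r ◅ map-verts f walk ps

  length-map-tails : ∀ (f : ∀ {x y} → P x → R x y → R′ x y) {a b} (walk : Star R a b) ps →
                     length (tails (map-tails f walk ps)) ≡ length (tails walk)
  length-map-tails f ε          []        = refl
  length-map-tails f (r ◅ walk) (pa ∷ ps) = cong suc (length-map-tails f walk ps)

  length-map-verts : ∀ (f : ∀ {x y} → P y → R x y → R′ x y) {a b} (walk : Star R a b) ps →
                     length (tails (map-verts f walk ps)) ≡ length (tails walk)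
  length-map-verts f ε          _        = refl
  length-map-verts f (r ◅ walk) (_ ∷ ps) = cong suc (length-map-verts f walk ps)

-- Deciding reachability

module Reachability {n : ℕ} {R : Fin n → Fin n → Set} (R? : ∀ x y → Dec (R x y)) (a : Fin n) where

  -- Within t b: b is reachable from a in at most t steps.  Until these
  -- layers stabilise each one adds a vertex, so t = n suffices.
  Within : ℕ → Fin n → Set
  Within zero    b = a ≡ b
  Within (suc t) b = Within t b ⊎ ∃ λ y → Within t y × R y b

  within? : ∀ t b → Dec (Within t b)
  within? zero    b = a Fin.≟ b
  within? (suc t) b = within? t b ⊎-dec Fin.any? (λ y → within? t y ×-dec R? y b)

  within⇒star : ∀ {t b} → Within t b → Star R a b
  within⇒star {zero}  refl               = ε
  within⇒star {suc t} (inj₁ w)           = within⇒star w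
  within⇒star {suc t} (inj₂ (y , w , r)) = within⇒star w ◅◅ (r ◅ ε)

  star⇒within : ∀ {t x b} → Within t x → Star R x b → ∃ λ s → Within s b
  star⇒within w ε          = _ , w
  star⇒within w (r ◅ walk) = star⇒within (inj₂ (_ , w , r)) walk

  Stable : ℕ → Set
  Stable t = ∀ b → Within (suc t) b → Within t b

  stable-suc : ∀ {t} → Stable t → Stable (suc t)
  stable-suc stable b (inj₁ w)           = w
  stable-suc stable b (inj₂ (y , w , r)) = inj₂ (y , stable y w , r)

  size : ℕ → ℕ
  size t = sum (λ b → 𝟙 (within? t b))

  size≤n : ∀ t → size t ≤ n
  size≤n t = subst (size t ≤_) (sum-const-1 n) (sum-mono-≤ (λ b → 𝟙≤1 (within? t b)))

  stable-or-grows : ∀ t → Stable t ⊎ suc t ≤ size t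
  stable-or-grows zero = inj₂ (≤-trans (≤-reflexive (sym (𝟙-yes (within? 0 a) refl))) (≤-sum _ a))
  stable-or-grows (suc t) with stable-or-grows t
  ... | inj₁ stable = inj₁ (stable-suc stable)
  ... | inj₂ grown with Fin.any? (λ b → within? (suc t) b ×-dec ¬? (within? t b))
  ...   | no none = inj₁ (stable-suc λ b w → decidable-stable (within? t b) λ ¬w → none (b , w , ¬w))
  ...   | yes (b , new , ¬old) = inj₂ (<-≤-trans (s≤s grown) (sum-mono-< b
            (λ b′ → 𝟙-mono inj₁ (within? t b′) (within? (suc t) b′))
            (new-𝟙 (within? t b) (within? (suc t) b))))
    where
    new-𝟙 : (old? : Dec (Within t b)) (new? : Dec (Within (suc t) b)) → 𝟙 old? < 𝟙 new?
    new-𝟙 (yes old) _         = contradiction old ¬old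
    new-𝟙 (no _)    (yes _)   = s≤s z≤n
    new-𝟙 (no _)    (no ¬new) = contradiction new ¬new

  stable-beyond-n : ∀ d → Stable (d + n)
  stable-beyond-n zero with stable-or-grows n
  ... | inj₁ stable = stable
  ... | inj₂ grown  = contradiction (≤-trans grown (size≤n n)) 1+n≰n
  stable-beyond-n (suc d) = stable-suc (stable-beyond-n d)

  within-weaken : ∀ d {t b} → Within t b → Within (d + t) b
  within-weaken zero    w = w
  within-weaken (suc d) w = inj₁ (within-weaken d w)

  within-shrink : ∀ d {b} → Within (d + n) b → Within n b
  within-shrink zero    w = w
  within-shrink (suc d) w = within-shrink d (stable-beyond-n d _ w)

  within-n : ∀ t {b} → Within t b → Within n b
  within-n t w with t ≤? n
  ... | yes t≤n = subst (λ s → Within s _) (m∸n+n≡m t≤n) (within-weaken (n ∸ t) w)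
  ... | no t≰n  = within-shrink (t ∸ n) (subst (λ s → Within s _) (sym (m∸n+n≡m (≰⇒≥ t≰n))) w)

  reachable? : ∀ b → Dec (Star R a b)
  reachable? b with within? n b
  ... | yes w = yes (within⇒star w)
  ... | no ¬w = no λ walk → let t , w = star⇒within {0} refl walk in ¬w (within-n t w)

reachable? : ∀ {n} {R : Fin n → Fin n → Set} → (∀ x y → Dec (R x y)) → ∀ a b → Dec (Star R a b)
reachable? R? a = Reachability.reachable? R? a

module _ {m : ℕ} where

  next-last : ∀ (j : Fin (suc m)) → toℕ j ≡ m → next j ≡ zero
  next-last j j≡m with m ≟ toℕ j
  ... | yes _   = refl
  ... | no m≢j  = contradiction (sym j≡m) m≢j

  toℕ-next : ∀ (j : Fin (suc m)) → toℕ j ≢ m → toℕ (next j) ≡ suc (toℕ j)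
  toℕ-next j j≢m with m ≟ toℕ j
  ... | yes m≡j = contradiction (sym m≡j) j≢m
  ... | no m≢j  = cong suc (Fin.toℕ-lower₁ j m≢j)

  module _ {R : Fin (suc m) → Fin (suc m) → Set} (step : ∀ j → R j (next j)) where

    private
      forward : ∀ d j j′ → toℕ j + d ≡ m → toℕ j ≤ toℕ j′ → Star R j j′
      forward d j j′ j+d≡m j≤j′ with toℕ j ≟ toℕ j′
      ... | yes j≡j′ = subst (Star R j) (Fin.toℕ-injective j≡j′) ε
      forward zero    j j′ j+d≡m j≤j′ | no j≢j′ =
        contradiction (≤-antisym j≤j′ (subst (toℕ j′ ≤_) (trans (sym j+d≡m) (+-identityʳ _)) (Fin.toℕ≤pred[n] j′)))
                      j≢j′
      forward (suc d) j j′ j+d≡m j≤j′ | no j≢j′ = step j ◅ forward d (next j) j′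
        (trans (cong (_+ d) (toℕ-next j j≢m)) (trans (sym (+-suc (toℕ j) d)) j+d≡m))
        (subst (_≤ toℕ j′) (sym (toℕ-next j j≢m)) (≤∧≢⇒< j≤j′ j≢j′))
        where
        j≢m : toℕ j ≢ m
        j≢m j≡m = m+1+n≢m (toℕ j) (trans j+d≡m (sym j≡m))

      to-zero : ∀ j → Star R j zero
      to-zero j = forward (m ∸ toℕ j) j (fromℕ m) (m+[n∸m]≡n (Fin.toℕ≤pred[n] j)) (Fin.≤fromℕ j)
                    ◅◅ subst (R (fromℕ m)) (next-last (fromℕ m) (Fin.toℕ-fromℕ m)) (step (fromℕ m)) ◅ ε

    next-connected : ∀ j j′ → Star R j j′
    next-connected j j′ = to-zero j ◅◅ forward m zero j′ refl z≤n

next-≢ : ∀ {m} (j : Fin (suc (suc m))) → next j ≢ j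
next-≢ {m} j next≡j with toℕ j ≟ suc m
... | yes j≡m = 0≢1+n (trans (cong toℕ (trans (sym (next-last j j≡m)) next≡j)) j≡m)
... | no j≢m  = 1+n≢n (trans (sym (toℕ-next j j≢m)) (cong toℕ next≡j))

-- Arcs, and slides that create no monochromatic cycle

edge-injective : ∀ {n k} {x y x′ y′ : Fin n} {c c′ : Fin k} →
                 just (x , y , c) ≡ just (x′ , y′ , c′) → x ≡ x′ × y ≡ y′ × c ≡ c′
edge-injective refl = refl , refl , refl

module _ {n k : ℕ} where

  MonoArc : List (Edge n k) → Fin k → Fin n → Fin n → Set
  MonoArc E c x y = ∃ λ q → lookupℕ E q ≡ just (x , y , c)

  Arc : List (Edge n k) → Fin n → Fin n → Set
  Arc E x y = ∃ λ c → MonoArc E c x y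

  monoArc? : ∀ E c x y → Dec (MonoArc E c x y)
  monoArc? []      c x y = no λ { (_ , ()) }
  monoArc? (e ∷ E) c x y with Product.≡-dec Fin._≟_ (Product.≡-dec Fin._≟_ Fin._≟_) e (x , y , c) | monoArc? E c x y
  ... | yes refl | _              = yes (0 , refl)
  ... | no _     | yes (q , E[q]) = yes (suc q , E[q])
  ... | no e≢    | no ¬arc        = no λ { (zero , refl) → e≢ refl ; (suc q , E[q]) → ¬arc (q , E[q]) }

  arc? : ∀ E x y → Dec (Arc E x y)
  arc? E x y = Fin.any? λ c → monoArc? E c x y

  EdgeAt⇒lookupℕ : ∀ (E : List (Edge n k)) q e → EdgeAt E q e → lookupℕ E q ≡ just e
  EdgeAt⇒lookupℕ E _ e (j , refl , E[j]) = trans (lookupℕ-lookup E j) (cong just E[j])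

  EdgeAt-∷= : ∀ (E : List (Edge n k)) i e′ q e → EdgeAt (E [ i ]∷= e′) q e →
              (q ≡ toℕ i × e ≡ e′) ⊎ EdgeAt E q e
  EdgeAt-∷= E i e′ q e at with q ≟ toℕ i
  ... | yes refl = inj₁ (refl , just-injective (trans (sym (EdgeAt⇒lookupℕ (E [ i ]∷= e′) q e at))
                                                       (lookupℕ-∷=-updated E i e′)))
  ... | no q≢i   = inj₂ (lookupℕ⇒lookup E q (trans (sym (lookupℕ-∷=-other E i e′ q q≢i))
                                                  (EdgeAt⇒lookupℕ (E [ i ]∷= e′) q e at)))

  reverseSlide-clean : ∀ G i v w c → lookup (edges G) i ≡ (v , w , c) →
                       ¬ CreatesMonoCycle G (afterSlide G i v w c c)
  reverseSlide-clean G i v w c E[i] (c″ , m , vs , es , (vs-inj , es-inj , joins) , ¬cycle) =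
    ¬cycle (vs-inj , es-inj , λ j → [ restore , Sum.swap ∘ restore ]′ (joins j))
    where
    restore : ∀ {q x y} → EdgeAt (edges G [ i ]∷= (w , v , c)) q (x , y , c″) →
              EdgeAt (edges G) q (x , y , c″) ⊎ EdgeAt (edges G) q (y , x , c″)
    restore {q} at with EdgeAt-∷= (edges G) i _ q _ at
    ... | inj₁ (refl , refl) = inj₂ (i , refl , E[i])
    ... | inj₂ at′           = inj₁ at′

  -- Out-edges being unique per color forces the cycle to be directed.
  cycle⇒walk : ∀ {E c m vs es} → UniqueOutEdges E → IsCycle E c m vs es →
               ∀ j₀ {x y} → x ≢ y → lookupℕ E (es j₀) ≡ just (y , x , c) → Star (MonoArc E c) x y
  cycle⇒walk {E} {c} {zero} {vs} {es} _ (_ , _ , joins) zero x≢y E[j₀] = ⊥-elim ([ loop , loop ]′ (joins zero))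
    where
    loop : EdgeAt E (es zero) (vs zero , vs zero , c) → ⊥
    loop at with refl , refl , _ ← edge-injective (trans (sym (EdgeAt⇒lookupℕ E _ _ at)) E[j₀]) = x≢y refl
  cycle⇒walk {E} {c} {suc m} {vs} {es} unique (vs-inj , es-inj , joins) j₀ {x} {y} x≢y E[j₀] =
    oriented (directed j₀)
    where
    Fwd Bwd : Fin (suc (suc m)) → Set
    Fwd j = lookupℕ E (es j) ≡ just (vs j , vs (next j) , c)
    Bwd j = lookupℕ E (es j) ≡ just (vs (next j) , vs j , c)

    directed : ∀ j → Fwd j ⊎ Bwd j
    directed j = Sum.map (EdgeAt⇒lookupℕ E _ _) (EdgeAt⇒lookupℕ E _ _) (joins j)

    not-both : ∀ j → Bwd j → ¬ Fwd j
    not-both j bwd fwd = next-≢ j (sym (vs-inj (proj₁ (edge-injective (trans (sym fwd) bwd)))))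

    bwd-next : ∀ j → Bwd j → Bwd (next j)
    bwd-next j bwd with directed (next j)
    ... | inj₁ fwd  = contradiction (sym (es-inj (unique bwd fwd))) (next-≢ j)
    ... | inj₂ bwd′ = bwd′

    propagate-bwd : ∀ j j′ → Bwd j → Bwd j′
    propagate-bwd j j′ = fold (λ a b → Bwd a → Bwd b) (λ f g → g ∘ f) id (next-connected bwd-next j j′)

    oriented : Fwd j₀ ⊎ Bwd j₀ → Star (MonoArc E c) x y
    oriented (inj₁ fwd₀) with refl , refl , _ ← edge-injective (trans (sym fwd₀) E[j₀]) =
      gmap vs id (next-connected (λ j → es j , all-fwd j) (next j₀) j₀)
      where
      all-fwd : ∀ j → Fwd j
      all-fwd j with directed j
      ... | inj₁ fwd = fwd
      ... | inj₂ bwd = contradiction fwd₀ (not-both j₀ (propagate-bwd j j₀ bwd))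
    oriented (inj₂ bwd₀) with refl , refl , _ ← edge-injective (trans (sym bwd₀) E[j₀]) =
      gmap vs id (reverse id (next-connected {R = λ a b → MonoArc E c (vs b) (vs a)}
                               (λ j → es j , propagate-bwd j₀ j bwd₀) (next j₀) j₀))

  -- A new cycle must use the recolored arc w → v; the rest of it is a c′-walk
  -- from v to w, which once cut at its first visit of w uses only old arcs.
  recolorSlide-clean : ∀ G i v w c c′ → UniqueOutEdges (edges (afterSlide G i v w c c′)) →
                       ¬ Star (MonoArc (edges G) c′) v w → ¬ CreatesMonoCycle G (afterSlide G i v w c c′)
  recolorSlide-clean G i v w c c′ unique ¬walk (c″ , m , vs , es , cycle@(vs-inj , es-inj , joins) , ¬cycle)
    with Fin.any? (λ j → es j ≟ toℕ i)
  ... | no avoids = ¬cycle (vs-inj , es-inj , λ j → Sum.map (old j) (old j) (joins j))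
    where
    old : ∀ j {e} → EdgeAt (edges G [ i ]∷= (w , v , c′)) (es j) e → EdgeAt (edges G) (es j) e
    old j at = [ (λ (es≡i , _) → contradiction (j , es≡i) avoids) , id ]′ (EdgeAt-∷= (edges G) i _ (es j) _ at)
  ... | yes (j₀ , es≡i) = ¬walk (map-tails (_≢ w) restore (proj₁ avoiding) (proj₂ avoiding))
    where
    E′ : List (Edge n k)
    E′ = edges G [ i ]∷= (w , v , c′)

    E′[j₀] : lookupℕ E′ (es j₀) ≡ just (w , v , c′)
    E′[j₀] = trans (cong (lookupℕ E′) es≡i) (lookupℕ-∷=-updated (edges G) i _)

    color : ∀ {x y} → EdgeAt E′ (es j₀) (x , y , c″) → c″ ≡ c′
    color at = proj₂ (proj₂ (edge-injective (trans (sym (EdgeAt⇒lookupℕ E′ _ _ at)) E′[j₀])))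

    v≢w : v ≢ w
    v≢w refl = ¬walk ε

    avoiding : Σ (Star (MonoArc E′ c′) v w) λ walk → All (_≢ w) (tails walk)
    avoiding = avoidingEnd (cycle⇒walk {E = E′} unique
                 (subst (λ c → IsCycle E′ c m vs es) ([ color , color ]′ (joins j₀)) cycle) j₀ v≢w E′[j₀])

    restore : ∀ {x y} → x ≢ w → MonoArc E′ c′ x y → MonoArc (edges G) c′ x y
    restore x≢w (q , E′[q]) with q ≟ toℕ i
    ... | yes refl = contradiction (proj₁ (edge-injective (trans (sym E′[q]) (lookupℕ-∷=-updated (edges G) i _)))) x≢w
    ... | no q≢i   = q , trans (sym (lookupℕ-∷=-other (edges G) i _ q q≢i)) E′[q]

-- Gathering a pebble by clean slides

module Gathering {n k : ℕ} (ℓ : ℕ) where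

  pebble-afterSlide : ∀ (G : State n k) i v w c c′ → 1 ≤ peb (afterSlide G i v w c c′) v c
  pebble-afterSlide G i v w c c′ = subst (1 ≤_) (sym (incP-δ v c (decP w c′ (peb G)) v c))
    (subst (λ s → 1 ≤ decP w c′ (peb G) v c + s) (sym (cong₂ _*_ (δ-refl v) (δ-refl c))) (m≤n+m 1 _))

  configuration-afterSlide : ∀ {G : State n k} i v w c c′ → lookup (edges G) i ≡ (v , w , c) → 1 ≤ peb G w c′ →
                             Configuration ℓ G → Configuration ℓ (afterSlide G i v w c c′)
  configuration-afterSlide i v w c c′ E[i] 1≤peb conf = conf ◅◅ (slideMove (slide i v w c c′ E[i] 1≤peb) ◅ ε)

  MonoReach : State n k → Fin k → Fin n → Fin n → Set
  MonoReach G c x y = Star (MonoArc (edges G) c) x y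

  -- The rest of the walk is handled first; as z is not among its tails,
  -- the arc z → y survives those slides.
  pullBack : ∀ {G : State n k} {c z u} → Configuration ℓ G →
             (walk : MonoReach G c z u) → Unique (tails walk) → 1 ≤ peb G u c →
             ∃ λ G′ → Star CleanSlide G G′ × Configuration ℓ G′ × Moved G G′ u z × 1 ≤ peb G′ z c ×
               (∀ {q x y d} → All (x ≢_) (tails walk) → lookupℕ (edges G) q ≡ just (x , y , d) →
                              lookupℕ (edges G′) q ≡ just (x , y , d))
  pullBack {G} conf ε _ 1≤peb = G , ε , conf , Moved-refl , 1≤peb , λ _ E[q] → E[q]
  pullBack {G} {c} conf (_◅_ {z} {y} (q , E[q]) walk) (z∉ ∷ unique) 1≤peb
    with G₁ , slides , conf₁ , u→y , 1≤peb₁ , keep ← pullBack conf walk unique 1≤peb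
    with i , refl , E₁[i] ← lookupℕ⇒lookup (edges G₁) q (keep z∉ E[q]) =
    afterSlide G₁ i z y c c ,
    slides ◅◅ (slide i z y c c E₁[i] 1≤peb₁ , reverseSlide-clean G₁ i z y c E₁[i]) ◅ ε ,
    configuration-afterSlide i z y c c E₁[i] 1≤peb₁ conf₁ ,
    Moved-trans u→y (Moved-afterSlide G₁ i z y c c 1≤peb₁) ,
    pebble-afterSlide G₁ i z y c c ,
    keep′
    where
    keep′ : ∀ {q′ x y′ d} → All (x ≢_) (z ∷ tails walk) → lookupℕ (edges G) q′ ≡ just (x , y′ , d) →
            lookupℕ (edges G₁ [ i ]∷= (y , z , c)) q′ ≡ just (x , y′ , d)
    keep′ {q′} (x≢z ∷ x∉) E[q′] with q′ ≟ toℕ i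
    ... | yes refl = contradiction (proj₁ (edge-injective
                       (trans (sym (keep x∉ E[q′])) (trans (lookupℕ-lookup (edges G₁) i) (cong just E₁[i]))))) x≢z
    ... | no q′≢i  = trans (lookupℕ-∷=-other (edges G₁) i _ q′ q′≢i) (keep x∉ E[q′])

  -- Let c be the color of a pebble on u.  If some vertex z of the walk
  -- reaches u in color c, pull the pebble back to the first such z;
  -- otherwise slide it onto the last arc, recoloring that arc with c.
  -- Arcs leaving vertices that do not reach u are never touched.
  stepBack : ∀ {G : State n k} {a x u c} → Configuration ℓ G → 1 ≤ peb G u c →
             (prefix : Star (Arc (edges G)) a x) → Arc (edges G) x u →
             ∃₂ λ G′ z → Star CleanSlide G G′ × Configuration ℓ G′ × Moved G G′ u z ×
               Σ (Star (Arc (edges G′)) a z) λ prefix′ → length (tails prefix′) ≤ length (tails prefix)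
  stepBack {G} {x = x} {u} {c} conf 1≤peb prefix (c₀ , p , E[p])
    with firstSatisfying (λ t → reachable? (monoArc? (edges G) c) t u) prefix
  ... | inj₂ (z , prefix′ , unreaching , reach , shorter)
    with walk , unique ← simplify reach
    with G′ , slides , conf′ , u→z , _ , keep ← pullBack conf walk unique 1≤peb =
    G′ , z , slides , conf′ , u→z , map-tails _ transport prefix′ unreaching ,
    subst (_≤ length (tails prefix)) (sym (length-map-tails _ transport prefix′ unreaching)) shorter
    where
    transport : ∀ {t y} → ¬ MonoReach G c t u → Arc (edges G) t y → Arc (edges G′) t y
    transport ¬reach (d , q , E[q]) =
      d , q , keep (All.map (λ reaches t≡ → ¬reach (subst (λ s → MonoReach G c s u) (sym t≡) reaches))
                            (tails-reach walk)) E[q]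
  ... | inj₁ unreaching
    with i , refl , E[i] ← lookupℕ⇒lookup (edges G) p E[p] =
    G′ , x ,
    (slide i x u c₀ c E[i] 1≤peb , recolorSlide-clean G i x u c₀ c unique (All-verts⇒end prefix unreaching)) ◅ ε ,
    conf′ ,
    Moved-afterSlide G i x u c₀ c 1≤peb ,
    map-verts _ transport prefix unreaching ,
    ≤-reflexive (length-map-verts _ transport prefix unreaching)
    where
    G′ : State n k
    G′ = afterSlide G i x u c₀ c
    conf′ : Configuration ℓ G′
    conf′ = configuration-afterSlide i x u c₀ c E[i] 1≤peb conf
    unique : UniqueOutEdges (edges G′)
    unique = PebbleInvariant⇒UniqueOutEdges {G = G′} (PebbleInvariant-configuration conf′)
    transport : ∀ {t y} → ¬ MonoReach G c y u → Arc (edges G) t y → Arc (edges G′) t y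
    transport ¬reach (d , q , E[q]) with q ≟ toℕ i
    ... | yes refl = contradiction (subst (λ s → MonoReach G c s u)
                       (sym (proj₁ (proj₂ (edge-injective (trans (sym E[q]) E[p]))))) ε) ¬reach
    ... | no q≢i   = d , q , trans (lookupℕ-∷=-other (edges G) i _ q q≢i) E[q]

  module _ {Target : Fin n → Set} (target? : ∀ x → Dec (Target x)) where

    gather : ∀ fuel {G : State n k} {a u} → Configuration ℓ G → (walk : Star (Arc (edges G)) a u) →
             length (tails walk) ≤ fuel → Target a → 1 ≤ pebCount G u →
             ∃₂ λ G′ s → Star CleanSlide G G′ × Configuration ℓ G′ × Moved G G′ u s × Target s
    gather fuel {G} {u = u} conf walk short target-a pebble with target? u
    ... | yes target-u = G , u , ε , conf , Moved-refl , target-u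
    ... | no ¬target-u with unsnoc walk
    ...   | inj₁ refl = contradiction target-a ¬target-u
    ...   | inj₂ (x , prefix , arc , shorter) with fuel
    ...     | zero = contradiction (≤-trans shorter short) λ ()
    ...     | suc fuel′
      with c , 1≤peb ← pebble-color G u pebble
      with G₁ , z , slides , conf₁ , u→z , prefix′ , shorter′ ← stepBack conf 1≤peb prefix arc
      with G₂ , s , slides′ , conf₂ , z→s , target-s ←
             gather fuel′ conf₁ prefix′ (≤-pred (≤-trans (s≤s shorter′) (≤-trans shorter short))) target-a
                    (Moved⇒pebble u→z pebble) =
      G₂ , s , slides ◅◅ slides′ , conf₂ , Moved-trans u→z z→s , target-s

-- Weighted pebble counts

slides-preserve : ∀ {n k} (f : State n k → ℕ) → (∀ {G G′} → Slide G G′ → f G′ ≡ f G) →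
                  ∀ {G G′} → Star Slide G G′ → f G′ ≡ f G
slides-preserve f invariant = fold (λ G G′ → f G′ ≡ f G) (λ s eq → trans eq (invariant s)) refl

weightedCount : ∀ {n k} → (Fin n → ℕ) → State n k → ℕ
weightedCount ω G = sum (λ y → ω y * pebCount G y)

weightedCount-mono : ∀ {n k} {ω ω′ : Fin n → ℕ} → (∀ y → ω y ≤ ω′ y) → ∀ (G : State n k) →
                     weightedCount ω G ≤ weightedCount ω′ G
weightedCount-mono ω≤ω′ G = sum-mono-≤ (λ y → *-monoˡ-≤ (pebCount G y) (ω≤ω′ y))

module Weighted {n k : ℕ} (ω : Fin n → ℕ) where

  count : State n k → ℕ
  count = weightedCount ω

  Moved-weighted : ∀ {G G′ u z} → Moved G G′ u z → count G′ + ω u ≡ count G + ω z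
  Moved-weighted {G} {G′} {u} {z} (moved balance) = begin
    count G′ + ω u                                  ≡⟨ cong (count G′ +_) (sum-*δ ω u) ⟨
    count G′ + sum (λ y → ω y * δ u y)              ≡⟨ sum-+-cong weighted-balance ⟩
    count G + sum (λ y → ω y * δ z y)               ≡⟨ cong (count G +_) (sum-*δ ω z) ⟩
    count G + ω z                                   ∎
    where
    open ≡-Reasoning
    weighted-balance : ∀ y → ω y * pebCount G′ y + ω y * δ u y ≡ ω y * pebCount G y + ω y * δ z y
    weighted-balance y = trans (sym (*-distribˡ-+ (ω y) _ _))
                           (trans (cong (ω y *_) (balance y)) (*-distribˡ-+ (ω y) _ _))

  tailWeight : Edge n k → ℕ
  tailWeight (s , _ , _) = ω s

  endsWeight : Edge n k → ℕ
  endsWeight (s , t , _) = ω s * ω t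

  potential : State n k → ℕ
  potential G = count G + sumMap tailWeight (edges G)

  -- A slide of v → w moves a pebble from w to v and the arc's tail from v to w.
  potential-slide : ∀ {G G′} → Slide G G′ → potential G′ ≡ potential G
  potential-slide {G} (slide i v w c c′ E[i] 1≤peb) =
    +-exchange {a = count (afterSlide G i v w c c′)} (Moved-weighted (Moved-afterSlide G i v w c c′ 1≤peb))
      (subst (λ e → sumMap tailWeight E′ + tailWeight e ≡ sumMap tailWeight (edges G) + ω w) E[i]
             (sumMap-∷= tailWeight (edges G) i (w , v , c′)))
    where
    E′ : List (Edge n k)
    E′ = edges G [ i ]∷= (w , v , c′)

  endsWeight-slide : ∀ {G G′} → Slide G G′ → sumMap endsWeight (edges G′) ≡ sumMap endsWeight (edges G)
  endsWeight-slide {G} (slide i v w c c′ E[i] _) = +-cancelʳ-≡ (ω v * ω w) _ _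
    (subst (λ e → sumMap endsWeight E′ + endsWeight e ≡ sumMap endsWeight (edges G) + ω v * ω w) E[i]
           (trans (sumMap-∷= endsWeight (edges G) i (w , v , c′)) (cong (sumMap endsWeight (edges G) +_) (*-comm (ω w) (ω v)))))
    where
    E′ : List (Edge n k)
    E′ = edges G [ i ]∷= (w , v , c′)

  -- Slides keep the potential and the ends weight; if no arc of H leaves
  -- the support, then the tail weight of H equals its ends weight, which
  -- bounds the tail weight of T from below.
  closed-bound : ∀ {H₀ H T : State n k} → (∀ y → ω y ≤ 1) →
                 (∀ q {e} → lookupℕ (edges H) q ≡ just e → tailWeight e ≡ endsWeight e) →
                 Star Slide H₀ H → Star Slide H₀ T → count T ≤ count H
  closed-bound {H₀} {H} {T} ω≤1 closed H₀⇝H H₀⇝T = +-cancelʳ-≤ (sumMap tailWeight (edges T)) _ _ (begin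
    count T + sumMap tailWeight (edges T)   ≡⟨ trans (slides-preserve potential potential-slide H₀⇝T)
                                                     (sym (slides-preserve potential potential-slide H₀⇝H)) ⟩
    count H + sumMap tailWeight (edges H)   ≡⟨ cong (count H +_) (sumMap-cong (edges H) closed) ⟩
    count H + sumMap endsWeight (edges H)   ≡⟨ cong (count H +_) (trans (slides-preserve ends endsWeight-slide H₀⇝H)
                                                                    (sym (slides-preserve ends endsWeight-slide H₀⇝T))) ⟩
    count H + sumMap endsWeight (edges T)   ≤⟨ +-monoʳ-≤ (count H) (sumMap-mono-≤ ends≤tail (edges T)) ⟩
    count H + sumMap tailWeight (edges T)   ∎)
    where
    open ≤-Reasoning
    ends : State n k → ℕ
    ends G = sumMap endsWeight (edges G)
    ends≤tail : ∀ e → endsWeight e ≤ tailWeight e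
    ends≤tail (s , t , _) = subst (ω s * ω t ≤_) (*-identityʳ (ω s)) (*-monoʳ-≤ (ω s) (ω≤1 t))

-- Pebbles on the pair {v , w}

module Pair {n k : ℕ} (ℓ : ℕ) (v w : Fin n) where

  open Gathering {n} {k} ℓ

  InPair : Fin n → Set
  InPair y = y ≡ v ⊎ y ≡ w

  inPair? : ∀ y → Dec (InPair y)
  inPair? y = (y Fin.≟ v) ⊎-dec (y Fin.≟ w)

  pebOnPair-sym : ∀ (G : State n k) → pebOnPair G w v ≡ pebOnPair G v w
  pebOnPair-sym G with v Fin.≟ w | w Fin.≟ v
  ... | yes refl | yes _    = refl
  ... | no _     | no _     = +-comm (pebCount G w) (pebCount G v)
  ... | yes v≡w  | no w≢v   = contradiction (sym v≡w) w≢v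
  ... | no v≢w   | yes w≡v  = contradiction (sym w≡v) v≢w

  pairWeight : Fin n → ℕ
  pairWeight = 𝟙 ∘ inPair?

  pairWeight-in : ∀ (G : State n k) y → InPair y → pairWeight y * pebCount G y ≡ pebCount G y
  pairWeight-in G y p = trans (cong (_* pebCount G y) (𝟙-yes (inPair? y) p)) (*-identityˡ _)

  pairWeight-out : ∀ (G : State n k) y → ¬ InPair y → pairWeight y * pebCount G y ≡ 0
  pairWeight-out G y ¬p = cong (_* pebCount G y) (𝟙-no (inPair? y) ¬p)

  pebOnPair-weighted : ∀ (G : State n k) → pebOnPair G v w ≡ weightedCount pairWeight G
  pebOnPair-weighted G with v Fin.≟ w
  ... | yes refl = sym (trans (sum-supported _ v λ y y≢v → pairWeight-out G y [ y≢v , y≢v ]′)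
                              (pairWeight-in G v (inj₁ refl)))
  ... | no v≢w   = sym (trans (sum-supported₂ _ v w v≢w λ y y≢v y≢w → pairWeight-out G y [ y≢v , y≢w ]′)
                              (cong₂ _+_ (pairWeight-in G v (inj₁ refl)) (pairWeight-in G w (inj₂ refl))))

  pebOnPair-Moved : ∀ {G G′ : State n k} {u s} → Moved G G′ u s → ¬ InPair u → InPair s →
                    pebOnPair G′ v w ≡ suc (pebOnPair G v w)
  pebOnPair-Moved {G} {G′} {u} {s} u→s ¬pair-u pair-s = begin
    pebOnPair G′ v w                          ≡⟨ pebOnPair-weighted G′ ⟩
    weightedCount pairWeight G′               ≡⟨ +-identityʳ _ ⟨
    weightedCount pairWeight G′ + 0           ≡⟨ cong (_ +_) (𝟙-no (inPair? u) ¬pair-u) ⟨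
    weightedCount pairWeight G′ + pairWeight u ≡⟨ Weighted.Moved-weighted pairWeight u→s ⟩
    weightedCount pairWeight G + pairWeight s ≡⟨ cong (_ +_) (𝟙-yes (inPair? s) pair-s) ⟩
    weightedCount pairWeight G + 1            ≡⟨ +-comm _ 1 ⟩
    suc (weightedCount pairWeight G)          ≡⟨ cong suc (pebOnPair-weighted G) ⟨
    suc (pebOnPair G v w)                     ∎
    where open ≡-Reasoning

  ReachedFromPair : State n k → Fin n → Set
  ReachedFromPair G y = Star (Arc (edges G)) v y ⊎ Star (Arc (edges G)) w y

  reachedFromPair? : ∀ G y → Dec (ReachedFromPair G y)
  reachedFromPair? G y = reachable? (arc? (edges G)) v y ⊎-dec reachable? (arc? (edges G)) w y

  -- The set reached from the pair has no arc leaving it, and by assumption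
  -- all its pebbles lie on the pair.
  unreachable-bound : ∀ {H₀ H T : State n k} → Star Slide H₀ H → Star Slide H₀ T →
                      (∀ u → ¬ InPair u → ReachedFromPair H u → pebCount H u ≡ 0) →
                      pebOnPair T v w ≤ pebOnPair H v w
  unreachable-bound {H₀} {H} {T} H₀⇝H H₀⇝T empty = begin
    pebOnPair T v w                ≡⟨ pebOnPair-weighted T ⟩
    weightedCount pairWeight T
      ≤⟨ weightedCount-mono (λ y → 𝟙-mono pair⇒reached (inPair? y) (reachedFromPair? H y)) T ⟩
    weightedCount reachWeight T
      ≤⟨ Weighted.closed-bound reachWeight (λ y → 𝟙≤1 (reachedFromPair? H y)) closed H₀⇝H H₀⇝T ⟩
    weightedCount reachWeight H    ≡⟨ sum-cong-≗ (λ y → same-on-H (inPair? y) (reachedFromPair? H y)) ⟩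
    weightedCount pairWeight H     ≡⟨ pebOnPair-weighted H ⟨
    pebOnPair H v w                ∎
    where
    open ≤-Reasoning
    reachWeight : Fin n → ℕ
    reachWeight = 𝟙 ∘ reachedFromPair? H

    pair⇒reached : ∀ {y} → InPair y → ReachedFromPair H y
    pair⇒reached (inj₁ refl) = inj₁ ε
    pair⇒reached (inj₂ refl) = inj₂ ε

    closed : ∀ q {e} → lookupℕ (edges H) q ≡ just e →
             Weighted.tailWeight reachWeight e ≡ Weighted.endsWeight reachWeight e
    closed q {a , b , d} E[q] = tail⇒head (reachedFromPair? H a) (reachedFromPair? H b)
      where
      tail⇒head : (a? : Dec (ReachedFromPair H a)) (b? : Dec (ReachedFromPair H b)) → 𝟙 a? ≡ 𝟙 a? * 𝟙 b?
      tail⇒head (yes _)       (yes _)  = refl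
      tail⇒head (yes reached) (no ¬b)  = contradiction (Sum.map extend extend reached) ¬b
        where
        extend : ∀ {s} → Star (Arc (edges H)) s a → Star (Arc (edges H)) s b
        extend walk = walk ◅◅ (d , q , E[q]) ◅ ε
      tail⇒head (no _)        _        = refl

    same-on-H : ∀ {y} (pair? : Dec (InPair y)) (reached? : Dec (ReachedFromPair H y)) →
                𝟙 reached? * pebCount H y ≡ 𝟙 pair? * pebCount H y
    same-on-H (yes _)    (yes _)        = refl
    same-on-H (yes pair) (no ¬reached)  = contradiction (pair⇒reached pair) ¬reached
    same-on-H (no ¬pair) (yes reached)  = trans (*-identityˡ _) (empty _ ¬pair reached)
    same-on-H (no _)     (no _)         = refl

  fetch : ∀ {H : State n k} {u} → Configuration ℓ H → ReachedFromPair H u → 1 ≤ pebCount H u →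
          ∃₂ λ H′ s → Star CleanSlide H H′ × Configuration ℓ H′ × Moved H H′ u s × InPair s
  fetch conf (inj₁ walk) = gather inPair? _ conf walk ≤-refl (inj₁ refl)
  fetch conf (inj₂ walk) = gather inPair? _ conf walk ≤-refl (inj₂ refl)

  -- Each round brings one more pebble to the pair; the budget counts the
  -- rounds that can still be needed.
  collect : ∀ budget {H₀ H T : State n k} → Configuration ℓ H → Star Slide H₀ H → Star Slide H₀ T →
            ℓ + 1 ≤ pebOnPair T v w → ℓ + 1 ≤ pebOnPair H v w + budget →
            ∃ λ H′ → Star CleanSlide H H′ × ℓ + 1 ≤ pebOnPair H′ v w
  collect budget {H = H} conf H₀⇝H H₀⇝T enough-T within-budget with ℓ + 1 ≤? pebOnPair H v w
  ... | yes enough = H , ε , enough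
  ... | no short with Fin.any? (λ u → ¬? (inPair? u) ×-dec ((1 ≤? pebCount H u) ×-dec reachedFromPair? H u))
  ...   | no none = contradiction (≤-trans enough-T (unreachable-bound H₀⇝H H₀⇝T empty)) short
    where
    empty : ∀ u → ¬ InPair u → ReachedFromPair H u → pebCount H u ≡ 0
    empty u ¬pair reached = n<1⇒n≡0 (≰⇒> λ pebble → none (u , ¬pair , pebble , reached))
  ...   | yes (u , ¬pair , pebble , reached) with budget
  ...     | zero = contradiction (subst (ℓ + 1 ≤_) (+-identityʳ _) within-budget) short
  ...     | suc budget′
    with H₁ , s , slides , conf₁ , u→s , pair-s ← fetch conf reached pebble
    with H′ , slides′ , enough ← collect budget′ conf₁ (H₀⇝H ◅◅ gmap id proj₁ slides) H₀⇝T enough-T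
           (subst (ℓ + 1 ≤_) (trans (+-suc _ budget′) (cong (_+ budget′) (sym (pebOnPair-Moved u→s ¬pair pair-s))))
                  within-budget) =
    H′ , slides ◅◅ slides′ , enough

  addAllowed⇒enough : ∀ {G : State n k} → AddAllowed ℓ G v w → ℓ + 1 ≤ pebOnPair G v w
  addAllowed⇒enough     (inj₁ (_ , enough)) = enough
  addAllowed⇒enough {G} (inj₂ (_ , enough)) = subst (ℓ + 1 ≤_) (pebOnPair-sym G) enough

  pebOnPair-pebble : ∀ (G : State n k) → 1 ≤ pebOnPair G v w → 1 ≤ pebCount G v ⊎ 1 ≤ pebCount G w
  pebOnPair-pebble G 1≤pair with v Fin.≟ w | 1 ≤? pebCount G v
  ... | yes _ | _       = inj₁ 1≤pair
  ... | no _  | yes 1≤v = inj₁ 1≤v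
  ... | no _  | no 1≰v  = inj₂ (subst (λ p → 1 ≤ p + pebCount G w) (n<1⇒n≡0 (≰⇒> 1≰v)) 1≤pair)

  enough⇒addAllowed : ∀ {G : State n k} → ℓ + 1 ≤ pebOnPair G v w → AddAllowed ℓ G v w
  enough⇒addAllowed {G} enough with pebOnPair-pebble G (≤-trans (m≤n+m 1 ℓ) enough)
  ... | inj₁ 1≤v = inj₁ (1≤v , enough)
  ... | inj₂ 1≤w = inj₂ (1≤w , subst (ℓ + 1 ≤_) (sym (pebOnPair-sym G)) enough)

  clean-slides-suffice : ∀ {H T : State n k} → Configuration ℓ H → Star Slide H T → AddAllowed ℓ T v w →
                         ∃ λ H′ → Star CleanSlide H H′ × AddAllowed ℓ H′ v w
  clean-slides-suffice {H} conf H⇝T allowed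
    with H′ , slides , enough ←
           collect (ℓ + 1) conf ε H⇝T (addAllowed⇒enough allowed) (m≤n+m (ℓ + 1) (pebOnPair H v w)) =
    H′ , slides , enough⇒addAllowed enough

lemma9 : ∀ {n k ℓ : ℕ} → ℓ < 2 * k → (H : State n k) → Configuration ℓ H →
         (v w : Fin n) →
         ∃ (λ H' → Star Slide H H' × AddAllowed ℓ H' v w) →
         ∃ (λ H'' → Star CleanSlide H H'' × AddAllowed ℓ H'' v w)
lemma9 {ℓ = ℓ} _ H conf v w (T , H⇝T , allowed) = Pair.clean-slides-suffice ℓ v w conf H⇝T allowed
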